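{- For the online minimum cut problem in the vertex arrival model there exists a greedy online algorithm $\mathbf A$ — one that places $v_1$ in $X$ and $v_2$ in $Y$, and for $i\ge3$ places $v_i$ in $X$ if $|v_i,X|>|v_i,Y|$, in $Y$ if $|v_i,X|<|v_i,Y|$, and otherwise decides by a tie-breaking rule depending only on the revealed induced subgraph $G[\{v_1,\dots,v_i\}]$ — with the following property: for every loopless graph $G$ with at least two vertices there exists a permutation of $V(G)$ such that, when given this permutation as its arrival order, $\mathbf A$ produces a minimum cut of $G$.
   Context: Graphs are loopless and may have parallel edges. In the vertex arrival model vertices $v_1,\dots,v_n$ are revealed one at a time, each with its edges to previously revealed vertices, and the algorithm irrevocably places each vertex in part $X$ or $Y$ (the algorithm does not know $n$). For disjoint vertex sets, $|v,X|$ is the number of edges between $v$ and the current set $X$. A minimum cut is a partition $(X,Y)$ of $V$ with both parts nonempty minimizing the number of edges between $X$ and $Y$. -}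

module Defs where

open import Data.Nat using (ℕ; zero; suc; _+_; _≤_; _<_; _≥_; _<ᵇ_)
open import Data.Fin using (Fin; fromℕ; inject₁)
open import Data.Fin.Permutation using (Permutation′; _⟨$⟩ʳ_; _⟨$⟩ˡ_)
open import Data.Vec using (Vec; []; _∷ʳ_; lookup; sum; tabulate; zipWith)
open import Data.Bool using (Bool; true; false; if_then_else_)
open import Data.Product using (Σ; ∃; _×_)
open import Relation.Binary.PropositionalEquality using (_≡_)

record Multigraph (n : ℕ) : Set where
  field
    adj      : Fin n → Fin n → ℕ
    adj-sym  : ∀ i j → adj i j ≡ adj j i
    loopless : ∀ i → adj i i ≡ 0
open Multigraph public

data Side : Set where
  X Y : Side

_==ˢ_ : Side → Side → Bool
X ==ˢ X = true
Y ==ˢ Y = true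
_ ==ˢ _ = false

-- Raw adjacency of a revealed graph on k vertices (vertex j = (j+1)-th arrival).
Adj : ℕ → Set
Adj k = Fin k → Fin k → ℕ

restrict : ∀ {k} → Adj (suc k) → Adj k
restrict H i j = H (inject₁ i) (inject₁ j)

-- A tie-breaking rule: when vertex number k (0-based, i.e. v_{k+1}) arrives,
-- it sees the revealed induced subgraph G[{v_1,...,v_{k+1}}] (vertices
-- labelled by arrival order) and returns a side.
TieRule : Set
TieRule = (k : ℕ) → Adj (suc k) → Side

degTo : ∀ {k} → Vec Side k → Adj (suc k) → Side → ℕ
degTo {k} prev H s =
  sum (zipWith (λ s' e → if s' ==ˢ s then e else 0)
               prev (tabulate (λ j → H (fromℕ k) (inject₁ j))))

mutual
  greedySides : TieRule → (k : ℕ) → Adj k → Vec Side k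
  greedySides tb zero H = []
  greedySides tb (suc k) H = greedySides tb k (restrict H) ∷ʳ greedyPlace tb k H

  greedyPlace : TieRule → (k : ℕ) → Adj (suc k) → Side
  greedyPlace tb zero H = X
  greedyPlace tb (suc zero) H = Y
  greedyPlace tb (suc (suc k)) H =
    let prev = greedySides tb (suc (suc k)) (restrict H)
        dX   = degTo prev H X
        dY   = degTo prev H Y
    in if dY <ᵇ dX then X else (if dX <ᵇ dY then Y else tb (suc (suc k)) H)

-- Graph G relabelled by an arrival order π: vertex i of the result is v_{i+1} = π(i).
arrive : ∀ {n} → Multigraph n → Permutation′ n → Adj n
arrive G π i j = adj G (π ⟨$⟩ʳ i) (π ⟨$⟩ʳ j)

greedyCut : ∀ {n} → TieRule → Multigraph n → Permutation′ n → Fin n → Side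
greedyCut {n} tb G π v = lookup (greedySides tb n (arrive G π)) (π ⟨$⟩ˡ v)

ΣFin : (n : ℕ) → (Fin n → ℕ) → ℕ
ΣFin n f = sum (tabulate f)

cutSize : ∀ {n} → Multigraph n → (Fin n → Side) → ℕ
cutSize {n} G c =
  ΣFin n (λ u → ΣFin n (λ v →
    if c u ==ˢ X then (if c v ==ˢ Y then adj G u v else 0) else 0))

ProperCut : ∀ {n} → (Fin n → Side) → Set
ProperCut c = (∃ λ u → c u ≡ X) × (∃ λ v → c v ≡ Y)

IsMinCut : ∀ {n} → Multigraph n → (Fin n → Side) → Set
IsMinCut {n} G c = ProperCut c × (∀ (d : Fin n → Side) → ProperCut d → cutSize G c ≤ cutSize G d)

module Submission where

-- The algorithm A breaks ties towards X.  Given G, we build an arrival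
-- order in which A reproduces some minimum cut, one arrival at a time.
--
-- The state after K steps is an order π and a minimum cut c such that A,
-- run on the first K arrivals of π, puts each of them on its side in c.
-- To place arrival K we look for a not yet placed vertex that A would put
-- on its c-side, and swap it into position K.  If there is none, every
-- unplaced vertex has at least as many edges to its own side among the
-- placed vertices as to the other one; flipping the sides of all unplaced
-- vertices then does not increase the cut (double counting, see
-- cutOf-flipOutside), so the flipped cut is again minimum and now agrees
-- with A at position K.  For K < 2 a fitting vertex always exists.

open import Defs
open import Data.Nat using (ℕ; zero; suc; _+_; _≤_; _<_; _≥_; _<ᵇ_; z≤n; s≤s; s≤s⁻¹)
open import Data.Nat.Properties
  using (≤-refl; ≤-reflexive; ≤-trans; <-trans; <-irrefl; module ≤-Reasoning; <⇒≤; ≮⇒≥; ≰⇒>; ≤⇒≯; <-≤-trans; m≤n⇒m<n∨m≡n;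
         +-mono-≤; +-mono-<; +-identityʳ; +-0-commutativeMonoid; <ᵇ-reflects-<; _≤?_)
open import Data.Bool using (Bool; true; false; if_then_else_)
open import Data.Fin using (Fin; zero; suc; toℕ; inject₁; fromℕ; fromℕ<)
open import Data.Fin.Properties
  using (_≟_; toℕ-injective; toℕ-inject₁; toℕ-fromℕ; toℕ-fromℕ<; toℕ<n; any?)
open import Data.Fin.Permutation
  using (Permutation′; _⟨$⟩ʳ_; _⟨$⟩ˡ_; inverseˡ; inverseʳ; id; transpose; _∘ₚ_)
import Data.Fin.Permutation.Components as PC
open import Data.Fin.Subset using (Subset; ⁅_⁆)
open import Data.Fin.Subset.Properties using (anySubset?)
open import Data.Vec using (_∷_; _∷ʳ_; lookup; sum; tabulate; zipWith)
open import Data.Vec.Properties using (lookup∘tabulate)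
open import Data.Empty using (⊥-elim)
open import Data.Sum using (inj₁; inj₂)
open import Data.Product using (Σ; ∃; ∃₂; _×_; _,_; proj₁; proj₂)
open import Function using (_∘_)
open import Relation.Binary.PropositionalEquality
open import Relation.Nullary using (¬_; Dec; yes; no)
open import Relation.Nullary.Decidable using (_×-dec_; dec-true; dec-false)
open import Relation.Nullary.Reflects using (ofʸ; ofⁿ)
open import Algebra.Properties.CommutativeMonoid.Sum +-0-commutativeMonoid
  using (sum-syntax; sum-cong-≗; sum-init-last; ∑-comm; ∑-distrib-+; ∑-permute)

other : Side → Side
other X = Y
other Y = X

_≟ˢ_ : (s t : Side) → Dec (s ≡ t)
X ≟ˢ X = yes refl
X ≟ˢ Y = no λ ()
Y ≟ˢ X = no λ ()
Y ≟ˢ Y = yes refl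

≢⇒other : ∀ {s t : Side} → ¬ s ≡ t → t ≡ other s
≢⇒other {X} {X} s≢t = ⊥-elim (s≢t refl)
≢⇒other {X} {Y} _ = refl
≢⇒other {Y} {X} _ = refl
≢⇒other {Y} {Y} s≢t = ⊥-elim (s≢t refl)

<ᵇ≡true : ∀ {m n} → m < n → (m <ᵇ n) ≡ true
<ᵇ≡true {m} {n} m<n with m <ᵇ n | <ᵇ-reflects-< m n
... | true  | _       = refl
... | false | ofⁿ m≮n = ⊥-elim (m≮n m<n)

<ᵇ≡false : ∀ {m n} → n ≤ m → (m <ᵇ n) ≡ false
<ᵇ≡false {m} {n} n≤m with m <ᵇ n | <ᵇ-reflects-< m n
... | true  | ofʸ m<n = ⊥-elim (≤⇒≯ n≤m m<n)
... | false | _       = refl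

<ᵇ≡false⁻¹ : ∀ {m n} → (m <ᵇ n) ≡ false → n ≤ m
<ᵇ≡false⁻¹ {m} {n} eq with m <ᵇ n | <ᵇ-reflects-< m n | eq
... | false | ofⁿ m≮n | _ = ≮⇒≥ m≮n

ΣFin≡∑ : ∀ n (f : Fin n → ℕ) → ΣFin n f ≡ ∑[ i < n ] f i
ΣFin≡∑ zero f = refl
ΣFin≡∑ (suc n) f = cong (f zero +_) (ΣFin≡∑ n (f ∘ suc))

∑-mono-≤ : ∀ {n} {f g : Fin n → ℕ} → (∀ i → f i ≤ g i) → ∑[ i < n ] f i ≤ ∑[ i < n ] g i
∑-mono-≤ {zero} f≤g = z≤n
∑-mono-≤ {suc n} f≤g = +-mono-≤ (f≤g zero) (∑-mono-≤ (f≤g ∘ suc))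

sum-zipWith-tabulate : ∀ {A B : Set} {k} (g : A → B → ℕ) (a : Fin k → A) (b : Fin k → B) →
  sum (zipWith g (tabulate a) (tabulate b)) ≡ ∑[ j < k ] g (a j) (b j)
sum-zipWith-tabulate {k = zero} g a b = refl
sum-zipWith-tabulate {k = suc k} g a b =
  cong (g (a zero) (b zero) +_) (sum-zipWith-tabulate g (a ∘ suc) (b ∘ suc))

tabulate-∷ʳ : ∀ {A : Set} {k} (f : Fin (suc k) → A) → tabulate f ≡ tabulate (f ∘ inject₁) ∷ʳ f (fromℕ k)
tabulate-∷ʳ {k = zero} f = refl
tabulate-∷ʳ {k = suc k} f = cong (f zero ∷_) (tabulate-∷ʳ (f ∘ suc))

∑∑ : ∀ {n} → Adj n → ℕ
∑∑ {n} F = ∑[ u < n ] ∑[ v < n ] F u v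

∑∑-cong : ∀ {n} {F F′ : Adj n} → (∀ u v → F u v ≡ F′ u v) → ∑∑ F ≡ ∑∑ F′
∑∑-cong F≡F′ = sum-cong-≗ (λ u → sum-cong-≗ (F≡F′ u))

∑∑-+ : ∀ {n} (F F′ : Adj n) → ∑∑ (λ u v → F u v + F′ u v) ≡ ∑∑ F + ∑∑ F′
∑∑-+ {n} F F′ = trans (sum-cong-≗ (λ u → ∑-distrib-+ (F u) (F′ u)))
                      (∑-distrib-+ (λ u → ∑[ v < n ] F u v) (λ u → ∑[ v < n ] F′ u v))

prefix-cong : ∀ {n} K {f g : Fin n → ℕ} → (∀ j → toℕ j < K → f j ≡ g j) →
  ∑[ j < n ] (if toℕ j <ᵇ K then f j else 0) ≡ ∑[ j < n ] (if toℕ j <ᵇ K then g j else 0)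
prefix-cong K {f} {g} f≡g = sum-cong-≗ pointwise
  where
  pointwise : ∀ j → (if toℕ j <ᵇ K then f j else 0) ≡ (if toℕ j <ᵇ K then g j else 0)
  pointwise j with toℕ j <ᵇ K | <ᵇ-reflects-< (toℕ j) K
  ... | true  | ofʸ j<K = f≡g j j<K
  ... | false | _       = refl

prefix-init : ∀ {k K} → K ≤ k → (f : Fin (suc k) → ℕ) →
  ∑[ j < suc k ] (if toℕ j <ᵇ K then f j else 0) ≡ ∑[ j < k ] (if toℕ j <ᵇ K then f (inject₁ j) else 0)
prefix-init {k} {K} K≤k f = begin
    ∑[ j < suc k ] summand j
  ≡⟨ sum-init-last summand ⟩
    ∑[ j < k ] summand (inject₁ j) + summand (fromℕ k)
  ≡⟨ cong₂ _+_ (sum-cong-≗ (λ j → cong (λ m → if m <ᵇ K then f (inject₁ j) else 0) (toℕ-inject₁ j)))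
               lastVanishes ⟩
    ∑[ j < k ] (if toℕ j <ᵇ K then f (inject₁ j) else 0) + 0
  ≡⟨ +-identityʳ _ ⟩
    ∑[ j < k ] (if toℕ j <ᵇ K then f (inject₁ j) else 0)
  ∎
  where
  open ≡-Reasoning
  summand : Fin (suc k) → ℕ
  summand j = if toℕ j <ᵇ K then f j else 0
  lastVanishes : summand (fromℕ k) ≡ 0
  lastVanishes rewrite toℕ-fromℕ k | <ᵇ≡false K≤k = refl

prefix-full : ∀ {k} (f : Fin k → ℕ) → ∑[ j < k ] (if toℕ j <ᵇ k then f j else 0) ≡ ∑[ j < k ] f j
prefix-full {k} f = sum-cong-≗ pointwise
  where
  pointwise : ∀ j → (if toℕ j <ᵇ k then f j else 0) ≡ f j
  pointwise j with toℕ j <ᵇ k | <ᵇ-reflects-< (toℕ j) k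
  ... | true  | _        = refl
  ... | false | ofⁿ j≮k = ⊥-elim (j≮k (toℕ<n j))

alwaysX : TieRule
alwaysX _ _ = X

place : ℕ → ℕ → ℕ → Side
place zero _ _ = X
place (suc zero) _ _ = Y
place (suc (suc _)) dX dY = if dY <ᵇ dX then X else (if dX <ᵇ dY then Y else X)

greedyPlace≡place : ∀ k (H : Adj (suc k)) →
  greedyPlace alwaysX k H ≡
    place k (degTo (greedySides alwaysX k (restrict H)) H X) (degTo (greedySides alwaysX k (restrict H)) H Y)
greedyPlace≡place zero H = refl
greedyPlace≡place (suc zero) H = refl
greedyPlace≡place (suc (suc k)) H = refl

notChosen : ∀ k (d : Side → ℕ) t → ¬ place (suc (suc k)) (d X) (d Y) ≡ t → d t ≤ d (other t)
notChosen k d X notX with d Y <ᵇ d X | d X <ᵇ d Y | <ᵇ-reflects-< (d X) (d Y)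
... | true  | _     | _        = ⊥-elim (notX refl)
... | false | true  | ofʸ X<Y = <⇒≤ X<Y
... | false | false | _        = ⊥-elim (notX refl)
notChosen k d Y notY with d Y <ᵇ d X | <ᵇ-reflects-< (d Y) (d X) | d X <ᵇ d Y | <ᵇ-reflects-< (d X) (d Y)
... | true  | ofʸ Y<X | _     | _        = <⇒≤ Y<X
... | false | _       | true  | _        = ⊥-elim (notY refl)
... | false | _       | false | ofⁿ X≮Y = ≮⇒≥ X≮Y

degIn : ∀ {n} → (Fin n → Bool) → Adj n → (Fin n → Side) → Fin n → Side → ℕ
degIn {n} P A s u t = ∑[ v < n ] (if P v then (if s v ==ˢ t then A u v else 0) else 0)

deg : ∀ {n} → Adj n → (Fin n → Side) → ℕ → Fin n → Side → ℕ
deg A s K = degIn (λ v → toℕ v <ᵇ K) A s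

placeAt : ∀ {n} → Adj n → (Fin n → Side) → ℕ → Fin n → Side
placeAt A s K u = place K (deg A s K u X) (deg A s K u Y)

GreedyUpTo : ∀ {n} → Adj n → (Fin n → Side) → ℕ → Set
GreedyUpTo A s K = ∀ i → toℕ i < K → s i ≡ placeAt A s (toℕ i) i

greedySides-char : ∀ n (H : Adj n) (s : Fin n → Side) → GreedyUpTo H s n →
  greedySides alwaysX n H ≡ tabulate s
greedySides-char zero H s greedy = refl
greedySides-char (suc k) H s greedy =
  trans (cong₂ _∷ʳ_ earlierSides lastSide) (sym (tabulate-∷ʳ s))
  where
  open ≡-Reasoning
  degInit : ∀ i K → K ≤ k → ∀ t → deg H s K (inject₁ i) t ≡ deg (restrict H) (s ∘ inject₁) K i t
  degInit i K K≤k t = prefix-init K≤k (λ j → if s j ==ˢ t then H (inject₁ i) j else 0)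

  degLast : ∀ t → deg H s k (fromℕ k) t ≡ degTo (tabulate (s ∘ inject₁)) H t
  degLast t = begin
      deg H s k (fromℕ k) t
    ≡⟨ prefix-init ≤-refl (λ j → if s j ==ˢ t then H (fromℕ k) j else 0) ⟩
      ∑[ j < k ] (if toℕ j <ᵇ k then (if s (inject₁ j) ==ˢ t then H (fromℕ k) (inject₁ j) else 0) else 0)
    ≡⟨ prefix-full (λ j → if s (inject₁ j) ==ˢ t then H (fromℕ k) (inject₁ j) else 0) ⟩
      ∑[ j < k ] (if s (inject₁ j) ==ˢ t then H (fromℕ k) (inject₁ j) else 0)
    ≡⟨ sym (sum-zipWith-tabulate _ (s ∘ inject₁) _) ⟩
      degTo (tabulate (s ∘ inject₁)) H t
    ∎

  earlierSides : greedySides alwaysX k (restrict H) ≡ tabulate (s ∘ inject₁)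
  earlierSides = greedySides-char k (restrict H) (s ∘ inject₁) λ i i<k → begin
      s (inject₁ i)
    ≡⟨ greedy (inject₁ i) (s≤s (<⇒≤ (subst (_< k) (sym (toℕ-inject₁ i)) i<k))) ⟩
      placeAt H s (toℕ (inject₁ i)) (inject₁ i)
    ≡⟨ cong (λ K → placeAt H s K (inject₁ i)) (toℕ-inject₁ i) ⟩
      placeAt H s (toℕ i) (inject₁ i)
    ≡⟨ cong₂ (place (toℕ i)) (degInit i (toℕ i) (<⇒≤ i<k) X) (degInit i (toℕ i) (<⇒≤ i<k) Y) ⟩
      placeAt (restrict H) (s ∘ inject₁) (toℕ i) i
    ∎

  lastSide : greedyPlace alwaysX k H ≡ s (fromℕ k)
  lastSide = begin
      greedyPlace alwaysX k H
    ≡⟨ greedyPlace≡place k H ⟩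
      place k (degTo (greedySides alwaysX k (restrict H)) H X) (degTo (greedySides alwaysX k (restrict H)) H Y)
    ≡⟨ cong (λ p → place k (degTo p H X) (degTo p H Y)) earlierSides ⟩
      place k (degTo (tabulate (s ∘ inject₁)) H X) (degTo (tabulate (s ∘ inject₁)) H Y)
    ≡⟨ sym (cong₂ (place k) (degLast X) (degLast Y)) ⟩
      placeAt H s k (fromℕ k)
    ≡⟨ sym (cong (λ K → placeAt H s K (fromℕ k)) (toℕ-fromℕ k)) ⟩
      placeAt H s (toℕ (fromℕ k)) (fromℕ k)
    ≡⟨ sym (greedy (fromℕ k) (subst (_< suc k) (sym (toℕ-fromℕ k)) ≤-refl)) ⟩
      s (fromℕ k)
    ∎

placeAt-agree : ∀ {n} (A : Adj n) {s s′ : Fin n → Side} K →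
  (∀ j → toℕ j < K → s j ≡ s′ j) → ∀ u → placeAt A s K u ≡ placeAt A s′ K u
placeAt-agree A {s} {s′} K s≡s′ u = cong₂ (place K) (sameDeg X) (sameDeg Y)
  where
  sameDeg : ∀ t → deg A s K u t ≡ deg A s′ K u t
  sameDeg t = prefix-cong K (λ j j<K → cong (λ x → if x ==ˢ t then A u j else 0) (s≡s′ j j<K))

greedy-agree : ∀ {n} {A : Adj n} {s s′ : Fin n → Side} {K} →
  (∀ j → toℕ j < K → s j ≡ s′ j) → GreedyUpTo A s K → GreedyUpTo A s′ K
greedy-agree {A = A} s≡s′ greedy i i<K =
  trans (sym (s≡s′ i i<K))
        (trans (greedy i i<K) (placeAt-agree A (toℕ i) (λ j j<i → s≡s′ j (<-trans j<i i<K)) i))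

greedy-extend : ∀ {n} {A : Adj n} {s : Fin n → Side} {K} → GreedyUpTo A s K →
  (k : Fin n) → toℕ k ≡ K → s k ≡ placeAt A s K k → GreedyUpTo A s (suc K)
greedy-extend greedy k refl sk i i<1+k with m≤n⇒m<n∨m≡n (s≤s⁻¹ i<1+k)
... | inj₁ i<k = greedy i i<k
... | inj₂ i≡k rewrite toℕ-injective i≡k = sk

FixesBelow : ∀ {n} → ℕ → (Fin n → Fin n) → Set
FixesBelow K τ = ∀ j → toℕ j < K → τ j ≡ j

placeAt-reindex : ∀ {n} (A : Adj n) (s : Fin n → Side) {K τ} → FixesBelow K τ →
  ∀ u → placeAt (λ x y → A (τ x) (τ y)) (s ∘ τ) K u ≡ placeAt A s K (τ u)
placeAt-reindex A s {K} {τ} fixes u = cong₂ (place K) (sameDeg X) (sameDeg Y)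
  where
  sameDeg : ∀ t → deg (λ x y → A (τ x) (τ y)) (s ∘ τ) K u t ≡ deg A s K (τ u) t
  sameDeg t = prefix-cong K (λ j j<K → cong (λ x → if s x ==ˢ t then A (τ u) x else 0) (fixes j j<K))

greedy-reindex : ∀ {n} {A : Adj n} {s : Fin n → Side} {K τ} → FixesBelow K τ →
  GreedyUpTo A s K → GreedyUpTo (λ x y → A (τ x) (τ y)) (s ∘ τ) K
greedy-reindex {A = A} {s} {τ = τ} fixes greedy i i<K = begin
    s (τ i)
  ≡⟨ cong s (fixes i i<K) ⟩
    s i
  ≡⟨ greedy i i<K ⟩
    placeAt A s (toℕ i) i
  ≡⟨ cong (placeAt A s (toℕ i)) (sym (fixes i i<K)) ⟩
    placeAt A s (toℕ i) (τ i)
  ≡⟨ sym (placeAt-reindex A s (λ j j<i → fixes j (<-trans j<i i<K)) i) ⟩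
    placeAt (λ x y → A (τ x) (τ y)) (s ∘ τ) (toℕ i) i
  ∎
  where open ≡-Reasoning

transpose-fixesBelow : ∀ {n K} (a j : Fin n) → toℕ a ≡ K → K ≤ toℕ j → FixesBelow K (PC.transpose a j)
transpose-fixesBelow a j refl a≤j x x<a
  rewrite dec-false (x ≟ a) (λ x≡a → <-irrefl (cong toℕ x≡a) x<a)
        | dec-false (x ≟ j) (λ x≡j → <-irrefl (cong toℕ x≡j) (<-≤-trans x<a a≤j)) = refl

transpose-hit : ∀ {n} (a j : Fin n) → PC.transpose a j a ≡ j
transpose-hit a j rewrite dec-true (a ≟ a) refl = refl

fromXtoY : ∀ {n} → Adj n → (Fin n → Side) → Adj n
fromXtoY A d u v = if d u ==ˢ X then (if d v ==ˢ Y then A u v else 0) else 0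

cutOf : ∀ {n} → Adj n → (Fin n → Side) → ℕ
cutOf A d = ∑∑ (fromXtoY A d)

crossing : ∀ {n} → Adj n → (Fin n → Side) → Adj n
crossing A d u v = if d u ==ˢ d v then 0 else A u v

Symmetric : ∀ {n} → Adj n → Set
Symmetric A = ∀ u v → A u v ≡ A v u

cutOf-cong : ∀ {n} (A : Adj n) {d d′ : Fin n → Side} → (∀ v → d v ≡ d′ v) → cutOf A d ≡ cutOf A d′
cutOf-cong A d≡d′ =
  ∑∑-cong (λ u v → cong₂ (λ x y → if x ==ˢ X then (if y ==ˢ Y then A u v else 0) else 0) (d≡d′ u) (d≡d′ v))

cutSize≡cutOf : ∀ {n} (G : Multigraph n) (d : Fin n → Side) → cutSize G d ≡ cutOf (adj G) d
cutSize≡cutOf {n} G d =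
  trans (ΣFin≡∑ n (λ u → ΣFin n (fromXtoY (adj G) d u))) (sum-cong-≗ (λ u → ΣFin≡∑ n (fromXtoY (adj G) d u)))

cutOf-permute : ∀ {n} (A : Adj n) (d : Fin n → Side) (σ : Permutation′ n) →
  cutOf A d ≡ cutOf (λ u v → A (σ ⟨$⟩ʳ u) (σ ⟨$⟩ʳ v)) (d ∘ (σ ⟨$⟩ʳ_))
cutOf-permute A d σ =
  trans (∑-permute _ σ) (sum-cong-≗ (λ u → ∑-permute (fromXtoY A d (σ ⟨$⟩ʳ u)) σ))

-- Double counting: every crossing edge is counted once in each direction.
cutOf-double : ∀ {n} {A : Adj n} → Symmetric A → ∀ d → cutOf A d + cutOf A d ≡ ∑∑ (crossing A d)
cutOf-double {A = A} sym-A d = begin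
    cutOf A d + cutOf A d
  ≡⟨ cong (cutOf A d +_) (∑-comm (fromXtoY A d)) ⟩
    cutOf A d + ∑∑ (λ u v → fromXtoY A d v u)
  ≡⟨ sym (∑∑-+ (fromXtoY A d) (λ u v → fromXtoY A d v u)) ⟩
    ∑∑ (λ u v → fromXtoY A d u v + fromXtoY A d v u)
  ≡⟨ ∑∑-cong bothDirections ⟩
    ∑∑ (crossing A d)
  ∎
  where
  open ≡-Reasoning
  bothDirections : ∀ u v → fromXtoY A d u v + fromXtoY A d v u ≡ crossing A d u v
  bothDirections u v with d u | d v
  ... | X | X = refl
  ... | X | Y = +-identityʳ _
  ... | Y | X = sym-A v u
  ... | Y | Y = refl

-- Splitting a symmetric matrix along a set P: the blocks P×P and P̄×P̄,
-- and the off-diagonal block P̄×P, which by symmetry is counted twice.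
within : ∀ {n} → (Fin n → Bool) → Adj n → Adj n
within P F u v = if P u then (if P v then F u v else 0) else (if P v then 0 else F u v)

outIn : ∀ {n} → (Fin n → Bool) → Adj n → Adj n
outIn P F u v = if P u then 0 else (if P v then F u v else 0)

∑∑-split : ∀ {n} (P : Fin n → Bool) {F : Adj n} → Symmetric F →
  ∑∑ F ≡ ∑∑ (within P F) + (∑∑ (outIn P F) + ∑∑ (outIn P F))
∑∑-split P {F} sym-F = begin
    ∑∑ F
  ≡⟨ ∑∑-cong blocks ⟩
    ∑∑ (λ u v → within P F u v + (outIn P F u v + outIn P F v u))
  ≡⟨ trans (∑∑-+ (within P F) (λ u v → outIn P F u v + outIn P F v u))
           (cong (∑∑ (within P F) +_) (∑∑-+ (outIn P F) (λ u v → outIn P F v u))) ⟩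
    ∑∑ (within P F) + (∑∑ (outIn P F) + ∑∑ (λ u v → outIn P F v u))
  ≡⟨ cong (λ z → ∑∑ (within P F) + (∑∑ (outIn P F) + z)) (sym (∑-comm (outIn P F))) ⟩
    ∑∑ (within P F) + (∑∑ (outIn P F) + ∑∑ (outIn P F))
  ∎
  where
  open ≡-Reasoning
  blocks : ∀ u v → F u v ≡ within P F u v + (outIn P F u v + outIn P F v u)
  blocks u v with P u | P v
  ... | true  | true  = sym (+-identityʳ _)
  ... | true  | false = sym-F u v
  ... | false | true  = sym (+-identityʳ _)
  ... | false | false = sym (+-identityʳ _)

crossing-symmetric : ∀ {n} {A : Adj n} → Symmetric A → ∀ d → Symmetric (crossing A d)
crossing-symmetric sym-A d u v with d u | d v
... | X | X = refl
... | X | Y = sym-A u v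
... | Y | X = sym-A u v
... | Y | Y = refl

flipOutside : ∀ {n} → (Fin n → Bool) → (Fin n → Side) → Fin n → Side
flipOutside P s j = if P j then s j else other (s j)

within-flipOutside : ∀ {n} (A : Adj n) P s u v →
  within P (crossing A (flipOutside P s)) u v ≡ within P (crossing A s) u v
within-flipOutside A P s u v with P u | P v | s u | s v
... | true  | true  | _ | _ = refl
... | true  | false | _ | _ = refl
... | false | true  | _ | _ = refl
... | false | false | X | X = refl
... | false | false | X | Y = refl
... | false | false | Y | X = refl
... | false | false | Y | Y = refl

-- An edge from u ∉ P into P crosses after the flip iff it did not cross
-- before, so row u of the block P̄×P measures, before and after the flip,
-- the edges into P on the other side and on the own side of u.
outIn-flipOutside-row : ∀ {n} (A : Adj n) P s u →
  (P u ≡ false → degIn P A s u (s u) ≤ degIn P A s u (other (s u))) →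
  ∑[ v < n ] outIn P (crossing A (flipOutside P s)) u v ≤ ∑[ v < n ] outIn P (crossing A s) u v
outIn-flipOutside-row {n} A P s u ownSideHeavier with P u
... | true  = ≤-refl
... | false = begin
    ∑[ v < n ] (if P v then (if other (s u) ==ˢ flipOutside P s v then 0 else A u v) else 0)
  ≡⟨ sum-cong-≗ (afterFlip (s u)) ⟩
    degIn P A s u (s u)
  ≤⟨ ownSideHeavier refl ⟩
    degIn P A s u (other (s u))
  ≡⟨ sym (sum-cong-≗ (beforeFlip (s u))) ⟩
    ∑[ v < n ] (if P v then (if s u ==ˢ s v then 0 else A u v) else 0)
  ∎
  where
  open ≤-Reasoning
  afterFlip : ∀ t v → (if P v then (if other t ==ˢ flipOutside P s v then 0 else A u v) else 0) ≡
                      (if P v then (if s v ==ˢ t then A u v else 0) else 0)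
  afterFlip t v with P v | s v | t
  ... | false | _ | _ = refl
  ... | true  | X | X = refl
  ... | true  | X | Y = refl
  ... | true  | Y | X = refl
  ... | true  | Y | Y = refl

  beforeFlip : ∀ t v → (if P v then (if t ==ˢ s v then 0 else A u v) else 0) ≡
                       (if P v then (if s v ==ˢ other t then A u v else 0) else 0)
  beforeFlip t v with P v | s v | t
  ... | false | _ | _ = refl
  ... | true  | X | X = refl
  ... | true  | X | Y = refl
  ... | true  | Y | X = refl
  ... | true  | Y | Y = refl

halve-≤ : ∀ {a b} → a + a ≤ b + b → a ≤ b
halve-≤ a+a≤b+b = ≮⇒≥ (λ b<a → ≤⇒≯ a+a≤b+b (+-mono-< b<a b<a))

-- Proof: compare twice the cut, split along P.
cutOf-flipOutside : ∀ {n} {A : Adj n} → Symmetric A → (P : Fin n → Bool) (s : Fin n → Side) →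
  (∀ u → P u ≡ false → degIn P A s u (s u) ≤ degIn P A s u (other (s u))) →
  cutOf A (flipOutside P s) ≤ cutOf A s
cutOf-flipOutside {n} {A} sym-A P s ownSideHeavier = halve-≤ (begin
    cutOf A s′ + cutOf A s′
  ≡⟨ cutOf-double sym-A s′ ⟩
    ∑∑ (crossing A s′)
  ≡⟨ ∑∑-split P (crossing-symmetric sym-A s′) ⟩
    ∑∑ (within P (crossing A s′)) + (∑∑ (outIn P (crossing A s′)) + ∑∑ (outIn P (crossing A s′)))
  ≤⟨ +-mono-≤ (≤-reflexive (∑∑-cong (within-flipOutside A P s))) (+-mono-≤ (∑-mono-≤ rows) (∑-mono-≤ rows)) ⟩
    ∑∑ (within P (crossing A s)) + (∑∑ (outIn P (crossing A s)) + ∑∑ (outIn P (crossing A s)))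
  ≡⟨ sym (∑∑-split P (crossing-symmetric sym-A s)) ⟩
    ∑∑ (crossing A s)
  ≡⟨ sym (cutOf-double sym-A s) ⟩
    cutOf A s + cutOf A s
  ∎)
  where
  open ≤-Reasoning
  s′ : Fin n → Side
  s′ = flipOutside P s
  rows : ∀ u → ∑[ v < n ] outIn P (crossing A s′) u v ≤ ∑[ v < n ] outIn P (crossing A s) u v
  rows u = outIn-flipOutside-row A P s u (ownSideHeavier u)

proper? : ∀ {n} (d : Fin n → Side) → Dec (ProperCut d)
proper? d = any? (λ u → d u ≟ˢ X) ×-dec any? (λ v → d v ≟ˢ Y)

proper-resp : ∀ {n} {d d′ : Fin n → Side} → (∀ v → d v ≡ d′ v) → ProperCut d → ProperCut d′
proper-resp d≡d′ ((u , du) , (v , dv)) = (u , trans (sym (d≡d′ u)) du) , (v , trans (sym (d≡d′ v)) dv)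

cutSize-resp : ∀ {n} (G : Multigraph n) {d d′ : Fin n → Side} → (∀ v → d v ≡ d′ v) → cutSize G d ≡ cutSize G d′
cutSize-resp G {d} {d′} d≡d′ =
  trans (cutSize≡cutOf G d) (trans (cutOf-cong (adj G) d≡d′) (sym (cutSize≡cutOf G d′)))

isMinCut-resp : ∀ {n} (G : Multigraph n) {d d′ : Fin n → Side} → (∀ v → d v ≡ d′ v) → IsMinCut G d → IsMinCut G d′
isMinCut-resp G d≡d′ (proper , minimal) =
  proper-resp d≡d′ proper , λ e properE → subst (_≤ cutSize G e) (cutSize-resp G d≡d′) (minimal e properE)

leastWitness : ∀ {A : Set} (Q : A → Set) (w : A → ℕ) → (∀ b → Dec (∃ λ a → Q a × w a ≤ b)) →
  ∀ b a → Q a → w a ≤ b → ∃ λ a → Q a × (∀ a′ → Q a′ → w a ≤ w a′)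
leastWitness Q w bounded? zero a q wa≤0 = a , q , λ _ _ → ≤-trans wa≤0 z≤n
leastWitness Q w bounded? (suc b) a q wa≤1+b with bounded? b
... | yes (a′ , q′ , wa′≤b) = leastWitness Q w bounded? b a′ q′ wa′≤b
... | no noneBelow = a , q , λ a′ q′ → ≤-trans wa≤1+b (≰⇒> (λ wa′≤b → noneBelow (a′ , q′ , wa′≤b)))

-- A subset as a cut (its elements form the side X); subsets can be searched
-- exhaustively.
sideOf : ∀ {n} → Subset n → Fin n → Side
sideOf p v = if lookup p v then X else Y

sideOf-tabulate : ∀ {n} (d : Fin n → Side) v → sideOf (tabulate (λ u → d u ==ˢ X)) v ≡ d v
sideOf-tabulate d v rewrite lookup∘tabulate (λ u → d u ==ˢ X) v with d v
... | X = refl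
... | Y = refl

minimumCut : ∀ {n} (G : Multigraph n) → n ≥ 2 → ∃ (IsMinCut G)
minimumCut {suc (suc m)} G (s≤s (s≤s z≤n)) =
  fromLeast (leastWitness (ProperCut ∘ sideOf) cutOfSubset bounded? _ ⁅ zero ⁆ singleton ≤-refl)
  where
  cutOfSubset : Subset (suc (suc m)) → ℕ
  cutOfSubset p = cutSize G (sideOf p)

  bounded? : ∀ b → Dec (∃ λ p → ProperCut (sideOf p) × cutOfSubset p ≤ b)
  bounded? b = anySubset? (λ p → proper? (sideOf p) ×-dec (cutOfSubset p ≤? b))

  singleton : ProperCut (sideOf ⁅ zero ⁆)
  singleton = (zero , refl) , (suc zero , refl)

  fromLeast : (∃ λ p → ProperCut (sideOf p) × (∀ q → ProperCut (sideOf q) → cutOfSubset p ≤ cutOfSubset q)) →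
    ∃ (IsMinCut G)
  fromLeast (p , properP , leastP) = sideOf p , properP , λ d properD →
    subst (cutSize G (sideOf p) ≤_) (cutSize-resp G (sideOf-tabulate d))
      (leastP (tabulate (λ u → d u ==ˢ X)) (proper-resp (λ v → sym (sideOf-tabulate d v)) properD))

module Construction {m} (G : Multigraph (suc (suc m))) where

  n : ℕ
  n = suc (suc m)

  Agrees : Permutation′ n → (Fin n → Side) → ℕ → Set
  Agrees π c K = GreedyUpTo (arrive G π) (c ∘ (π ⟨$⟩ʳ_)) K

  State : ℕ → Set
  State K = ∃₂ λ π c → IsMinCut G c × Agrees π c K

  Fits : Permutation′ n → (Fin n → Side) → ℕ → Fin n → Set
  Fits π c K j = K ≤ toℕ j × c (π ⟨$⟩ʳ j) ≡ placeAt (arrive G π) (c ∘ (π ⟨$⟩ʳ_)) K j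

  fits? : ∀ π c K j → Dec (Fits π c K j)
  fits? π c K j = (K ≤? toℕ j) ×-dec (c (π ⟨$⟩ʳ j) ≟ˢ placeAt (arrive G π) (c ∘ (π ⟨$⟩ʳ_)) K j)

  moveToPosition : ∀ {π c K} (K<n : K < n) → Agrees π c K → ∀ j → Fits π c K j →
    Agrees (transpose (fromℕ< K<n) j ∘ₚ π) c (suc K)
  moveToPosition {π} {c} {K} K<n agrees j (K≤j , jFits) =
    greedy-extend {A = arrive G (transpose k j ∘ₚ π)}
      (greedy-reindex {A = arrive G π} fixes agrees) k (toℕ-fromℕ< K<n) kFits
    where
    open ≡-Reasoning
    k : Fin n
    k = fromℕ< K<n
    fixes : FixesBelow K (PC.transpose k j)
    fixes = transpose-fixesBelow k j (toℕ-fromℕ< K<n) K≤j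
    kFits : c (π ⟨$⟩ʳ PC.transpose k j k) ≡
            placeAt (arrive G (transpose k j ∘ₚ π)) (c ∘ (π ⟨$⟩ʳ_) ∘ PC.transpose k j) K k
    kFits = begin
        c (π ⟨$⟩ʳ PC.transpose k j k)
      ≡⟨ cong (λ x → c (π ⟨$⟩ʳ x)) (transpose-hit k j) ⟩
        c (π ⟨$⟩ʳ j)
      ≡⟨ jFits ⟩
        placeAt (arrive G π) (c ∘ (π ⟨$⟩ʳ_)) K j
      ≡⟨ cong (placeAt (arrive G π) (c ∘ (π ⟨$⟩ʳ_)) K) (sym (transpose-hit k j)) ⟩
        placeAt (arrive G π) (c ∘ (π ⟨$⟩ʳ_)) K (PC.transpose k j k)
      ≡⟨ sym (placeAt-reindex (arrive G π) (c ∘ (π ⟨$⟩ʳ_)) fixes k) ⟩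
        placeAt (arrive G (transpose k j ∘ₚ π)) (c ∘ (π ⟨$⟩ʳ_) ∘ PC.transpose k j) K k
      ∎

  flipUnplaced : Permutation′ n → (Fin n → Side) → ℕ → Fin n → Side
  flipUnplaced π c K = flipOutside (λ j → toℕ j <ᵇ K) (c ∘ (π ⟨$⟩ʳ_)) ∘ (π ⟨$⟩ˡ_)

  flipUnplaced-onArrivals : ∀ π c K j →
    flipUnplaced π c K (π ⟨$⟩ʳ j) ≡ flipOutside (λ i → toℕ i <ᵇ K) (c ∘ (π ⟨$⟩ʳ_)) j
  flipUnplaced-onArrivals π c K j = cong (flipOutside (λ i → toℕ i <ᵇ K) (c ∘ (π ⟨$⟩ʳ_))) (inverseˡ π)

  flipUnplaced-kept : ∀ π c K j → toℕ j < K → c (π ⟨$⟩ʳ j) ≡ flipUnplaced π c K (π ⟨$⟩ʳ j)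
  flipUnplaced-kept π c K j j<K rewrite flipUnplaced-onArrivals π c K j | <ᵇ≡true j<K = refl

  -- If no vertex fits at position K ≥ 2, every unplaced vertex has at
  -- least as many edges to its own side among the placed ones, so the flip
  -- does not increase the cut.
  flipUnplaced-smaller : ∀ {π c} k → (∀ j → ¬ Fits π c (suc (suc k)) j) →
    cutSize G (flipUnplaced π c (suc (suc k))) ≤ cutSize G c
  flipUnplaced-smaller {π} {c} k noneFits = begin
      cutSize G c′
    ≡⟨ trans (cutSize≡cutOf G c′) (cutOf-permute (adj G) c′ π) ⟩
      cutOf A (c′ ∘ (π ⟨$⟩ʳ_))
    ≡⟨ cutOf-cong A (flipUnplaced-onArrivals π c K) ⟩
      cutOf A (flipOutside P s)
    ≤⟨ cutOf-flipOutside {A = A} (λ u v → adj-sym G (π ⟨$⟩ʳ u) (π ⟨$⟩ʳ v)) P s heavier ⟩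
      cutOf A s
    ≡⟨ sym (trans (cutSize≡cutOf G c) (cutOf-permute (adj G) c π)) ⟩
      cutSize G c
    ∎
    where
    open ≤-Reasoning
    K : ℕ
    K = suc (suc k)
    A : Adj n
    A = arrive G π
    s : Fin n → Side
    s = c ∘ (π ⟨$⟩ʳ_)
    P : Fin n → Bool
    P j = toℕ j <ᵇ K
    c′ : Fin n → Side
    c′ = flipUnplaced π c K
    heavier : ∀ u → P u ≡ false → degIn P A s u (s u) ≤ degIn P A s u (other (s u))
    heavier u Pu = notChosen k (deg A s K u) (s u) (λ placed → noneFits u (<ᵇ≡false⁻¹ Pu , sym placed))

  flipStep : ∀ {π c} k (K<n : suc (suc k) < n) → IsMinCut G c → Agrees π c (suc (suc k)) →
    (∀ j → ¬ Fits π c (suc (suc k)) j) →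
    IsMinCut G (flipUnplaced π c (suc (suc k))) × Agrees π (flipUnplaced π c (suc (suc k))) (suc (suc (suc k)))
  flipStep {π} {c} k K<n (_ , minimal) agrees noneFits =
    (proper′ , λ d properD → ≤-trans (flipUnplaced-smaller {π} {c} k noneFits) (minimal d properD)) ,
    greedy-extend {A = A} (greedy-agree {A = A} placedKept agrees) k′ (toℕ-fromℕ< K<n) k′Fits
    where
    K : ℕ
    K = suc (suc k)
    A : Adj n
    A = arrive G π
    c′ : Fin n → Side
    c′ = flipUnplaced π c K
    placedKept : ∀ j → toℕ j < K → c (π ⟨$⟩ʳ j) ≡ c′ (π ⟨$⟩ʳ j)
    placedKept = flipUnplaced-kept π c K

    -- The first two arrivals keep their sides X and Y.
    proper′ : ProperCut c′
    proper′ = (π ⟨$⟩ʳ zero , keptSide zero (s≤s z≤n)) , (π ⟨$⟩ʳ suc zero , keptSide (suc zero) (s≤s (s≤s z≤n)))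
      where
      keptSide : ∀ i → toℕ i < K → c′ (π ⟨$⟩ʳ i) ≡ placeAt A (c ∘ (π ⟨$⟩ʳ_)) (toℕ i) i
      keptSide i i<K = trans (sym (placedKept i i<K)) (agrees i i<K)

    k′ : Fin n
    k′ = fromℕ< K<n

    -- The vertex at position K was misplaced by c, so it fits after the flip.
    k′Fits : c′ (π ⟨$⟩ʳ k′) ≡ placeAt A (c′ ∘ (π ⟨$⟩ʳ_)) K k′
    k′Fits = begin
        c′ (π ⟨$⟩ʳ k′)
      ≡⟨ flipUnplaced-onArrivals π c K k′ ⟩
        flipOutside (λ i → toℕ i <ᵇ K) (c ∘ (π ⟨$⟩ʳ_)) k′
      ≡⟨ cong (λ b → if b then c (π ⟨$⟩ʳ k′) else other (c (π ⟨$⟩ʳ k′))) (<ᵇ≡false K≤k′) ⟩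
        other (c (π ⟨$⟩ʳ k′))
      ≡⟨ sym (≢⇒other (λ placed → noneFits k′ (K≤k′ , placed))) ⟩
        placeAt A (c ∘ (π ⟨$⟩ʳ_)) K k′
      ≡⟨ placeAt-agree A K placedKept k′ ⟩
        placeAt A (c′ ∘ (π ⟨$⟩ʳ_)) K k′
      ∎
      where
      open ≡-Reasoning
      K≤k′ : K ≤ toℕ k′
      K≤k′ = ≤-reflexive (sym (toℕ-fromℕ< K<n))

  -- When no vertex fits: impossible for K < 2 since c is proper, and
  -- resolved by flipStep otherwise.
  resolveStuck : ∀ K → K < n → ∀ {π c} → IsMinCut G c → Agrees π c K → ¬ ∃ (Fits π c K) → State (suc K)
  resolveStuck zero _ {π} {c} (((u , cu≡X) , _) , _) _ noneFits =
    ⊥-elim (noneFits (π ⟨$⟩ˡ u , z≤n , trans (cong c (inverseʳ π)) cu≡X))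
  resolveStuck (suc zero) _ {π} {c} ((_ , (v , cv≡Y)) , _) agrees noneFits =
    ⊥-elim (noneFits (π ⟨$⟩ˡ v , notFirst (π ⟨$⟩ˡ v) onY , onY))
    where
    onY : c (π ⟨$⟩ʳ (π ⟨$⟩ˡ v)) ≡ Y
    onY = trans (cong c (inverseʳ π)) cv≡Y
    -- The first arrival is on side X.
    notFirst : ∀ i → c (π ⟨$⟩ʳ i) ≡ Y → 1 ≤ toℕ i
    notFirst zero onY′ with trans (sym (agrees zero (s≤s z≤n))) onY′
    ... | ()
    notFirst (suc i) _ = s≤s z≤n
  resolveStuck (suc (suc k)) K<n {π} {c} minCut agrees noneFits =
    π , flipUnplaced π c (suc (suc k)) , flipStep {π} {c} k K<n minCut agrees (λ j fits → noneFits (j , fits))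

  advance : ∀ K → K < n → State K → State (suc K)
  advance K K<n (π , c , minCut , agrees) with any? (fits? π c K)
  ... | yes (j , jFits) = transpose (fromℕ< K<n) j ∘ₚ π , c , minCut , moveToPosition {π} {c} K<n agrees j jFits
  ... | no noneFits = resolveStuck K K<n {π} {c} minCut agrees noneFits

  greedyRun : ∀ K → K ≤ n → State K
  greedyRun zero _ = id , proj₁ minCut , proj₂ minCut , λ _ ()
    where
    minCut : ∃ (IsMinCut G)
    minCut = minimumCut G (s≤s (s≤s z≤n))
  greedyRun (suc K) K<n = advance K K<n (greedyRun K (<⇒≤ K<n))

  greedyCut-agrees : ∀ {π c} → Agrees π c n → ∀ v → greedyCut alwaysX G π v ≡ c v
  greedyCut-agrees {π} {c} agrees v = begin
      lookup (greedySides alwaysX n (arrive G π)) (π ⟨$⟩ˡ v)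
    ≡⟨ cong (λ sides → lookup sides (π ⟨$⟩ˡ v)) (greedySides-char n (arrive G π) (c ∘ (π ⟨$⟩ʳ_)) agrees) ⟩
      lookup (tabulate (c ∘ (π ⟨$⟩ʳ_))) (π ⟨$⟩ˡ v)
    ≡⟨ lookup∘tabulate (c ∘ (π ⟨$⟩ʳ_)) (π ⟨$⟩ˡ v) ⟩
      c (π ⟨$⟩ʳ (π ⟨$⟩ˡ v))
    ≡⟨ cong c (inverseʳ π) ⟩
      c v
    ∎
    where open ≡-Reasoning

theorem11 : Σ TieRule λ tb →
    ∀ (n : ℕ) → n ≥ 2 → (G : Multigraph n) →
      ∃ λ (π : Permutation′ n) → IsMinCut G (greedyCut tb G π)
theorem11 = alwaysX , greedyFindsMinCut
  where
  greedyFindsMinCut : ∀ (n : ℕ) → n ≥ 2 → (G : Multigraph n) →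
    ∃ λ (π : Permutation′ n) → IsMinCut G (greedyCut alwaysX G π)
  greedyFindsMinCut (suc (suc m)) (s≤s (s≤s z≤n)) G = finish (greedyRun (suc (suc m)) ≤-refl)
    where
    open Construction G
    finish : State (suc (suc m)) → ∃ λ (π : Permutation′ (suc (suc m))) → IsMinCut G (greedyCut alwaysX G π)
    finish (π , c , minCut , agrees) =
      π , isMinCut-resp G (λ v → sym (greedyCut-agrees {π} {c} agrees v)) minCut
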